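{- Let $p$ be an odd prime and $j,m,n$ positive integers, and put $i=j\cdot 2^{m-1}p^{n}$. For each integer $l\ge 1$ let $f_l(x)$ denote the unique polynomial with $\deg f_l<\deg\Phi_{2^mp^n}$ and $f_l(x)\equiv x^l \pmod{\Phi_{2^mp^n}(x)}$, where $\Phi_{2^mp^n}(x)=\sum_{a=0}^{p-1}(-1)^a x^{a2^{m-1}p^{n-1}}$ is the $2^mp^n$-th cyclotomic polynomial. Then $f_i(x)=(-1)^j$; $f_{i-h}(x)=\sum_{a=0}^{p-2}(-1)^{a+j}x^{(a+1)2^{m-1}p^{n-1}-h}$ for $1\le h\le 2^{m-1}p^{n-1}$; and $f_{i+h}(x)=(-1)^j x^h$ for $1\le h<2^{m-1}p^{n-1}(p-1)$. -}

module Defs where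

open import Data.Nat using (ℕ; zero; suc; _≤_; _∸_; _≟_)
open import Data.Integer using (ℤ; 0ℤ; _+_; _-_; _*_)
open import Data.Product using (∃; _×_)
open import Relation.Nullary using (yes; no)
open import Relation.Binary.PropositionalEquality using (_≡_)

-- Polynomials with integer coefficients, given by their coefficient
-- function: (P k) is the coefficient of x^k.
Poly : Set
Poly = ℕ → ℤ

-- P has only finitely many nonzero coefficients, all below index B,
-- i.e. P is a polynomial of degree < B (the zero polynomial if B = 0).
DegLT : Poly → ℕ → Set
DegLT P B = ∀ k → B ≤ k → P k ≡ 0ℤ

IsPolynomial : Poly → Set
IsPolynomial P = ∃ λ B → DegLT P B

mono : ℤ → ℕ → Poly
mono c d k with k ≟ d
... | yes _ = c
... | no  _ = 0ℤ

sumℤ : ℕ → (ℕ → ℤ) → ℤ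
sumℤ zero    F = 0ℤ
sumℤ (suc N) F = sumℤ N F + F N

sumP : ℕ → (ℕ → Poly) → Poly
sumP N F k = sumℤ N (λ a → F a k)

_*P_ : Poly → Poly → Poly
(P *P Q) k = sumℤ (suc k) (λ i → P i * Q (k ∸ i))

CongMod : Poly → Poly → Poly → Set
CongMod F G M = ∃ λ Q → IsPolynomial Q × (∀ k → F k - G k ≡ (M *P Q) k)

module Submission where

-- Write p = p' + 1 (p' even, since p is odd), e = 2^(m-1) p^(n-1) and
-- E = p e, so that Φ = Σ_{a ≤ p'} (-1)^a x^(a e) and i = j E.  The whole
-- proof rests on two congruences modulo Φ, both read off from an explicit
-- product Φ · Q:
--   * x^E ≡ -1, because Φ · (x^e + 1) = x^E + 1 telescopes (p is odd);
--   * x^(s + p' e) ≡ Σ_{b < p'} (-1)^(b+1) x^(s + b e) for every s, because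
--     x^(s + p' e) is the leading term of Φ · x^s, with coefficient +1.
-- Iterating the first gives x^(t E) ≡ (-1)^t; multiplying by x^h gives the
-- reduction of x^(i+h), and multiplying by x^(E-h) and applying the second
-- with s = e - h gives the reduction of x^(i-h).

open import Defs
open import Data.Nat using (ℕ; zero; suc; _≤_; _<_; _∸_; _≟_; z≤n; s≤s)
  renaming (_*_ to _*ℕ_; _+_ to _+ℕ_; _^_ to _^ℕ_)
import Data.Nat.Properties as ℕP
open import Data.Nat.Primality using (Prime; prime⇒irreducible; ¬prime[1])
open import Data.Nat.Divisibility using (divides)
open import Data.Integer using (ℤ; 0ℤ; 1ℤ; -1ℤ; _+_; _-_; _*_; -_; _^_)
import Data.Integer.Properties as ℤP
open import Data.Integer.Tactic.RingSolver using (solve-∀)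
open import Algebra.Properties.CommutativeSemigroup ℕP.*-commutativeSemigroup
  using (x∙yz≈y∙xz)
open import Data.Product using (∃; _×_; _,_)
open import Data.Sum using (_⊎_; inj₁; inj₂)
open import Data.Empty using (⊥-elim)
open import Relation.Nullary using (yes; no)
open import Relation.Binary.PropositionalEquality

sumℤ-cong : ∀ N {F G : ℕ → ℤ} → (∀ a → a < N → F a ≡ G a) → sumℤ N F ≡ sumℤ N G
sumℤ-cong zero    F≡G = refl
sumℤ-cong (suc N) F≡G =
  cong₂ _+_ (sumℤ-cong N (λ a a<N → F≡G a (ℕP.m<n⇒m<1+n a<N))) (F≡G N ℕP.≤-refl)

sumℤ-zero : ∀ N {F : ℕ → ℤ} → (∀ a → a < N → F a ≡ 0ℤ) → sumℤ N F ≡ 0ℤ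
sumℤ-zero zero    F≡0 = refl
sumℤ-zero (suc N) F≡0 =
  cong₂ _+_ (sumℤ-zero N (λ a a<N → F≡0 a (ℕP.m<n⇒m<1+n a<N))) (F≡0 N ℕP.≤-refl)

sumℤ-+ : ∀ N (F G : ℕ → ℤ) → sumℤ N (λ a → F a + G a) ≡ sumℤ N F + sumℤ N G
sumℤ-+ zero    F G = refl
sumℤ-+ (suc N) F G rewrite sumℤ-+ N F G = interchange (sumℤ N F) (sumℤ N G) (F N) (G N)
  where
  interchange : ∀ a b c d → (a + b) + (c + d) ≡ (a + c) + (b + d)
  interchange = solve-∀

sumℤ-scale : ∀ N c (F : ℕ → ℤ) → sumℤ N (λ a → c * F a) ≡ c * sumℤ N F
sumℤ-scale zero    c F = sym (ℤP.*-zeroʳ c)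
sumℤ-scale (suc N) c F rewrite sumℤ-scale N c F = sym (ℤP.*-distribˡ-+ c (sumℤ N F) (F N))

sumℤ-telescope : ∀ N (g : ℕ → ℤ) → sumℤ N (λ a → g a - g (suc a)) ≡ g 0 - g N
sumℤ-telescope zero    g = sym (ℤP.+-inverseʳ (g 0))
sumℤ-telescope (suc N) g rewrite sumℤ-telescope N g = cancel (g 0) (g N) (g (suc N))
  where
  cancel : ∀ a b c → (a - b) + (b - c) ≡ a - c
  cancel = solve-∀

_≈P_ : Poly → Poly → Set
F ≈P G = ∀ k → F k ≡ G k

zeroP : Poly
zeroP _ = 0ℤ

_+P_ : Poly → Poly → Poly
(F +P G) k = F k + G k

scale : ℤ → Poly → Poly
scale c F k = c * F k

shift1 : Poly → Poly
shift1 F zero    = 0ℤ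
shift1 F (suc k) = F k

shift : ℕ → Poly → Poly
shift zero    F = F
shift (suc d) F = shift1 (shift d F)

shift1-cong : ∀ {F G} → F ≈P G → shift1 F ≈P shift1 G
shift1-cong F≈G zero    = refl
shift1-cong F≈G (suc k) = F≈G k

shift-cong : ∀ d {F G} → F ≈P G → shift d F ≈P shift d G
shift-cong zero    F≈G = F≈G
shift-cong (suc d) F≈G = shift1-cong (shift-cong d F≈G)

shift-sub : ∀ d {F G R} → (∀ k → F k - G k ≡ R k) → ∀ k → shift d F k - shift d G k ≡ shift d R k
shift-sub zero    F-G≡R k       = F-G≡R k
shift-sub (suc d) F-G≡R zero    = refl
shift-sub (suc d) F-G≡R (suc k) = shift-sub d F-G≡R k

shift-sumP : ∀ d N F → shift d (sumP N F) ≈P sumP N (λ a → shift d (F a))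
shift-sumP zero    N F k       = refl
shift-sumP (suc d) N F zero    = sym (sumℤ-zero N (λ _ _ → refl))
shift-sumP (suc d) N F (suc k) = shift-sumP d N F k

mono-at : ∀ c d k → k ≡ d → mono c d k ≡ c
mono-at c d k k≡d with k ≟ d
... | yes _   = refl
... | no k≢d  = ⊥-elim (k≢d k≡d)

mono-off : ∀ c d k → k ≢ d → mono c d k ≡ 0ℤ
mono-off c d k k≢d with k ≟ d
... | yes k≡d = ⊥-elim (k≢d k≡d)
... | no _    = refl

mono-cong : ∀ {c c' l l'} → c ≡ c' → l ≡ l' → mono c l ≈P mono c' l'
mono-cong refl refl k = refl

mono-scale : ∀ c d l → scale c (mono d l) ≈P mono (c * d) l
mono-scale c d l k with k ≟ l
... | yes _ = refl
... | no _  = ℤP.*-zeroʳ c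

mono-neg : ∀ c l → mono (- c) l ≈P (λ k → - mono c l k)
mono-neg c l k with k ≟ l
... | yes _ = refl
... | no _  = refl

shift-mono : ∀ d c l → shift d (mono c l) ≈P mono c (d +ℕ l)
shift-mono zero    c l k       = refl
shift-mono (suc d) c l zero    = sym (mono-off c (suc d +ℕ l) 0 (λ ()))
shift-mono (suc d) c l (suc k) = trans (shift-mono d c l k) (moved k)
  where
  moved : ∀ k → mono c (d +ℕ l) k ≡ mono c (suc d +ℕ l) (suc k)
  moved k with k ≟ d +ℕ l
  ... | yes k≡ = sym (mono-at c _ (suc k) (cong suc k≡))
  ... | no k≢  = sym (mono-off c _ (suc k) (λ sk≡ → k≢ (ℕP.suc-injective sk≡)))

DegLT-mono : ∀ c {d B} → d < B → DegLT (mono c d) B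
DegLT-mono c d<B k B≤k = mono-off c _ k (λ k≡d → ℕP.<⇒≢ (ℕP.<-≤-trans d<B B≤k) (sym k≡d))

DegLT-sumP : ∀ N {F : ℕ → Poly} {B} → (∀ a → a < N → DegLT (F a) B) → DegLT (sumP N F) B
DegLT-sumP N deg k B≤k = sumℤ-zero N (λ a a<N → deg a a<N k B≤k)

poly-zero : IsPolynomial zeroP
poly-zero = 0 , λ _ _ → refl

poly-mono : ∀ c d → IsPolynomial (mono c d)
poly-mono c d = suc d , DegLT-mono c ℕP.≤-refl

poly-+ : ∀ {F G} → IsPolynomial F → IsPolynomial G → IsPolynomial (F +P G)
poly-+ (B , F<B) (C , G<C) = B +ℕ C , λ k B+C≤k →
  cong₂ _+_ (F<B k (ℕP.m+n≤o⇒m≤o B B+C≤k)) (G<C k (ℕP.m+n≤o⇒n≤o B B+C≤k))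

poly-scale : ∀ c {F} → IsPolynomial F → IsPolynomial (scale c F)
poly-scale c (B , F<B) = B , λ k B≤k → trans (cong (c *_) (F<B k B≤k)) (ℤP.*-zeroʳ c)

poly-shift : ∀ d {F} → IsPolynomial F → IsPolynomial (shift d F)
poly-shift zero    F-poly = F-poly
poly-shift (suc d) F-poly with poly-shift d F-poly
... | B , F<B = suc B , λ { zero () ; (suc k) (s≤s B≤k) → F<B k B≤k }

*P-cong : ∀ P {Q Q'} → Q ≈P Q' → (P *P Q) ≈P (P *P Q')
*P-cong P Q≈Q' k = sumℤ-cong (suc k) (λ i _ → cong (P i *_) (Q≈Q' (k ∸ i)))

*P-+ : ∀ P Q R → (P *P (Q +P R)) ≈P ((P *P Q) +P (P *P R))
*P-+ P Q R k = trans (sumℤ-cong (suc k) (λ i _ → ℤP.*-distribˡ-+ (P i) (Q (k ∸ i)) (R (k ∸ i))))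
                     (sumℤ-+ (suc k) _ _)

*P-scale : ∀ P c Q → (P *P scale c Q) ≈P scale c (P *P Q)
*P-scale P c Q k = trans (sumℤ-cong (suc k) (λ i _ → swap (P i) c (Q (k ∸ i))))
                         (sumℤ-scale (suc k) c _)
  where
  swap : ∀ a b d → a * (b * d) ≡ b * (a * d)
  swap = solve-∀

*P-zero : ∀ P → (P *P zeroP) ≈P zeroP
*P-zero P k = sumℤ-zero (suc k) (λ i _ → ℤP.*-zeroʳ (P i))

-- (P · x Q)_{k+1} = (P Q)_k: the top term of the convolution vanishes
*P-shift1 : ∀ P Q → (P *P shift1 Q) ≈P shift1 (P *P Q)
*P-shift1 P Q zero    = trans (ℤP.+-identityˡ _) (ℤP.*-zeroʳ (P 0))
*P-shift1 P Q (suc k) =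
  begin
    sumℤ (suc k) (λ i → P i * shift1 Q (suc k ∸ i)) + P (suc k) * shift1 Q (k ∸ k)
  ≡⟨ cong₂ _+_ (sumℤ-cong (suc k) (λ i i≤k → cong (λ z → P i * shift1 Q z)
                                               (ℕP.+-∸-assoc 1 (ℕP.≤-pred i≤k))))
               (cong (λ z → P (suc k) * shift1 Q z) (ℕP.n∸n≡0 k)) ⟩
    sumℤ (suc k) (λ i → P i * Q (k ∸ i)) + P (suc k) * 0ℤ
  ≡⟨ cong (sumℤ (suc k) (λ i → P i * Q (k ∸ i)) +_) (ℤP.*-zeroʳ (P (suc k))) ⟩
    sumℤ (suc k) (λ i → P i * Q (k ∸ i)) + 0ℤ
  ≡⟨ ℤP.+-identityʳ _ ⟩
    sumℤ (suc k) (λ i → P i * Q (k ∸ i))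
  ∎
  where open ≡-Reasoning

*P-shift : ∀ d P Q → (P *P shift d Q) ≈P shift d (P *P Q)
*P-shift zero    P Q k = refl
*P-shift (suc d) P Q k = trans (*P-shift1 P (shift d Q) k) (shift1-cong (*P-shift d P Q) k)

*P-one : ∀ P → (P *P mono 1ℤ 0) ≈P P
*P-one P k =
  begin
    sumℤ k (λ i → P i * mono 1ℤ 0 (k ∸ i)) + P k * mono 1ℤ 0 (k ∸ k)
  ≡⟨ cong₂ _+_ (sumℤ-zero k (λ i i<k → trans (cong (P i *_) (mono-off 1ℤ 0 (k ∸ i) (positive i<k)))
                                              (ℤP.*-zeroʳ (P i))))
               (cong (P k *_) (mono-at 1ℤ 0 (k ∸ k) (ℕP.n∸n≡0 k))) ⟩
    0ℤ + P k * 1ℤ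
  ≡⟨ trans (ℤP.+-identityˡ _) (ℤP.*-identityʳ (P k)) ⟩
    P k
  ∎
  where
  open ≡-Reasoning
  positive : ∀ {i} → i < k → k ∸ i ≢ 0
  positive i<k k∸i≡0 = ℕP.<⇒≢ (ℕP.m<n⇒0<n∸m i<k) (sym k∸i≡0)

*P-monomial : ∀ P s → (P *P mono 1ℤ s) ≈P shift s P
*P-monomial P s k =
  begin
    (P *P mono 1ℤ s) k
  ≡⟨ *P-cong P (λ k' → trans (mono-cong refl (sym (ℕP.+-identityʳ s)) k') (sym (shift-mono s 1ℤ 0 k'))) k ⟩
    (P *P shift s (mono 1ℤ 0)) k
  ≡⟨ *P-shift s P (mono 1ℤ 0) k ⟩
    shift s (P *P mono 1ℤ 0) k
  ≡⟨ shift-cong s (*P-one P) k ⟩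
    shift s P k
  ∎
  where open ≡-Reasoning

module Congruence (M : Poly) where

  cg-≈ : ∀ {F G} → F ≈P G → CongMod F G M
  cg-≈ {F} {G} F≈G = zeroP , poly-zero , λ k →
    trans (cong (_- G k) (F≈G k)) (trans (ℤP.+-inverseʳ (G k)) (sym (*P-zero M k)))

  cg-resp : ∀ {F F' G G'} → F ≈P F' → G ≈P G' → CongMod F G M → CongMod F' G' M
  cg-resp F≈F' G≈G' (Q , Q-poly , F-G≡MQ) =
    Q , Q-poly , λ k → trans (sym (cong₂ _-_ (F≈F' k) (G≈G' k))) (F-G≡MQ k)

  cg-trans : ∀ {F G H} → CongMod F G M → CongMod G H M → CongMod F H M
  cg-trans {F} {G} {H} (Q , Q-poly , F-G≡MQ) (R , R-poly , G-H≡MR) =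
    Q +P R , poly-+ Q-poly R-poly , λ k →
      trans (split (F k) (G k) (H k))
            (trans (cong₂ _+_ (F-G≡MQ k) (G-H≡MR k)) (sym (*P-+ M Q R k)))
    where
    split : ∀ a b c → a - c ≡ (a - b) + (b - c)
    split = solve-∀

  cg-scale : ∀ c {F G} → CongMod F G M → CongMod (scale c F) (scale c G) M
  cg-scale c {F} {G} (Q , Q-poly , F-G≡MQ) = scale c Q , poly-scale c Q-poly , λ k →
    trans (factor c (F k) (G k)) (trans (cong (c *_) (F-G≡MQ k)) (sym (*P-scale M c Q k)))
    where
    factor : ∀ a b d → a * b - a * d ≡ a * (b - d)
    factor = solve-∀

  cg-shift : ∀ d {F G} → CongMod F G M → CongMod (shift d F) (shift d G) M
  cg-shift d (Q , Q-poly , F-G≡MQ) = shift d Q , poly-shift d Q-poly , λ k →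
    trans (shift-sub d F-G≡MQ k) (sym (*P-shift d M Q k))

  cg-mono-shift : ∀ d {a b c} → CongMod (mono 1ℤ a) (mono c b) M →
                  CongMod (mono 1ℤ (d +ℕ a)) (mono c (d +ℕ b)) M
  cg-mono-shift d x^a≡cx^b = cg-resp (shift-mono d 1ℤ _) (shift-mono d _ _) (cg-shift d x^a≡cx^b)

  cg-mono-scale : ∀ c {a G} → CongMod (mono 1ℤ a) G M → CongMod (mono c a) (scale c G) M
  cg-mono-scale c x^a≡G =
    cg-resp (λ k → trans (mono-scale c 1ℤ _ k) (mono-cong (ℤP.*-identityʳ c) refl k))
            (λ _ → refl) (cg-scale c x^a≡G)

-- The alternating polynomial Φ = Σ_{a ≤ p'} (-1)^a x^(a e) for p = p' + 1 odd
-- (this is Φ_{2^m p^n} when e = 2^(m-1) p^(n-1)), and its period E = p e.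

module Alternating (p' e : ℕ) (p'-even : -1ℤ ^ p' ≡ 1ℤ) where

  p E : ℕ
  p = suc p'
  E = p *ℕ e

  Φ : Poly
  Φ = sumP p (λ a → mono (-1ℤ ^ a) (a *ℕ e))

  open Congruence Φ

  Φ-times-monomial : ∀ s → (Φ *P mono 1ℤ s) ≈P sumP p (λ b → mono (-1ℤ ^ b) (s +ℕ b *ℕ e))
  Φ-times-monomial s k =
    trans (*P-monomial Φ s k)
          (trans (shift-sumP s p _ k) (sumℤ-cong p (λ b _ → shift-mono s (-1ℤ ^ b) (b *ℕ e) k)))

  -- x^E ≡ -1, since Φ · (x^e + 1) = x^E + 1 by telescoping (p odd)
  power-period : CongMod (mono 1ℤ E) (mono -1ℤ 0) Φ
  power-period = mono 1ℤ e +P mono 1ℤ 0 , poly-+ (poly-mono 1ℤ e) (poly-mono 1ℤ 0) , λ k → sym (product k)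
    where
    term : ℕ → ℕ → ℤ
    term k b = mono (-1ℤ ^ b) (b *ℕ e) k
    next-term : ∀ k b → mono (-1ℤ ^ b) (e +ℕ b *ℕ e) k ≡ - term k (suc b)
    next-term k b =
      trans (sym (ℤP.neg-involutive _))
            (cong -_ (sym (trans (mono-cong (ℤP.-1*i≡-i (-1ℤ ^ b)) refl k) (mono-neg (-1ℤ ^ b) _ k))))
    ends : ∀ a b → a - (- b) ≡ b - (- a)
    ends = solve-∀
    product : ∀ k → (Φ *P (mono 1ℤ e +P mono 1ℤ 0)) k ≡ mono 1ℤ E k - mono -1ℤ 0 k
    product k =
      begin
        (Φ *P (mono 1ℤ e +P mono 1ℤ 0)) k
      ≡⟨ *P-+ Φ (mono 1ℤ e) (mono 1ℤ 0) k ⟩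
        (Φ *P mono 1ℤ e) k + (Φ *P mono 1ℤ 0) k
      ≡⟨ ℤP.+-comm ((Φ *P mono 1ℤ e) k) ((Φ *P mono 1ℤ 0) k) ⟩
        (Φ *P mono 1ℤ 0) k + (Φ *P mono 1ℤ e) k
      ≡⟨ cong₂ _+_ (Φ-times-monomial 0 k) (Φ-times-monomial e k) ⟩
        sumℤ p (term k) + sumℤ p (λ b → mono (-1ℤ ^ b) (e +ℕ b *ℕ e) k)
      ≡⟨ sym (sumℤ-+ p (term k) _) ⟩
        sumℤ p (λ b → term k b + mono (-1ℤ ^ b) (e +ℕ b *ℕ e) k)
      ≡⟨ sumℤ-cong p (λ b _ → cong (term k b +_) (next-term k b)) ⟩
        sumℤ p (λ b → term k b - term k (suc b))
      ≡⟨ sumℤ-telescope p (term k) ⟩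
        mono 1ℤ 0 k - mono (-1ℤ ^ p) E k
      ≡⟨ cong (λ z → mono 1ℤ 0 k - z) (trans (mono-cong (cong (-1ℤ *_) p'-even) refl k) (mono-neg 1ℤ E k)) ⟩
        mono 1ℤ 0 k - (- mono 1ℤ E k)
      ≡⟨ ends (mono 1ℤ 0 k) (mono 1ℤ E k) ⟩
        mono 1ℤ E k - (- mono 1ℤ 0 k)
      ≡⟨ cong (λ z → mono 1ℤ E k - z) (sym (mono-neg 1ℤ 0 k)) ⟩
        mono 1ℤ E k - mono -1ℤ 0 k
      ∎
      where open ≡-Reasoning

  power-multiple : ∀ t → CongMod (mono 1ℤ (t *ℕ E)) (mono (-1ℤ ^ t) 0) Φ
  power-multiple zero    = cg-≈ {mono 1ℤ 0} (λ _ → refl)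
  power-multiple (suc t) =
    cg-trans {mono 1ℤ (suc t *ℕ E)} {mono (-1ℤ ^ t) (E +ℕ 0)} {mono (-1ℤ ^ suc t) 0}
             (cg-mono-shift E (power-multiple t)) times-period
    where
    times-period : CongMod (mono (-1ℤ ^ t) (E +ℕ 0)) (mono (-1ℤ ^ suc t) 0) Φ
    times-period =
      cg-resp (mono-cong refl (sym (ℕP.+-identityʳ E)))
              (λ k → trans (mono-scale (-1ℤ ^ t) -1ℤ 0 k) (mono-cong (ℤP.*-comm (-1ℤ ^ t) -1ℤ) refl k))
              (cg-mono-scale (-1ℤ ^ t) power-period)

  power-above-multiple : ∀ t h → CongMod (mono 1ℤ (t *ℕ E +ℕ h)) (mono (-1ℤ ^ t) h) Φ
  power-above-multiple t h =
    cg-resp (mono-cong refl (ℕP.+-comm h (t *ℕ E))) (mono-cong refl (ℕP.+-identityʳ h))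
            (cg-mono-shift h (power-multiple t))

  -- x^(s + p' e) is the leading term of Φ · x^s, so
  -- x^(s + p' e) ≡ Σ_{b < p'} (-1)^(b+1) x^(s + b e)
  power-top : ∀ s → CongMod (mono 1ℤ (s +ℕ p' *ℕ e))
                            (sumP p' (λ b → mono (-1ℤ ^ suc b) (s +ℕ b *ℕ e))) Φ
  power-top s = mono 1ℤ s , poly-mono 1ℤ s , λ k → sym (product k)
    where
    lower : ℕ → ℕ → ℤ
    lower k b = mono (-1ℤ ^ b) (s +ℕ b *ℕ e) k
    move : ∀ a t → a + t ≡ t - (- a)
    move = solve-∀
    product : ∀ k → (Φ *P mono 1ℤ s) k ≡
                    mono 1ℤ (s +ℕ p' *ℕ e) k - sumP p' (λ b → mono (-1ℤ ^ suc b) (s +ℕ b *ℕ e)) k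
    product k =
      begin
        (Φ *P mono 1ℤ s) k
      ≡⟨ Φ-times-monomial s k ⟩
        sumℤ p' (lower k) + mono (-1ℤ ^ p') (s +ℕ p' *ℕ e) k
      ≡⟨ cong (sumℤ p' (lower k) +_) (mono-cong p'-even refl k) ⟩
        sumℤ p' (lower k) + mono 1ℤ (s +ℕ p' *ℕ e) k
      ≡⟨ move (sumℤ p' (lower k)) (mono 1ℤ (s +ℕ p' *ℕ e) k) ⟩
        mono 1ℤ (s +ℕ p' *ℕ e) k - (- sumℤ p' (lower k))
      ≡⟨ cong (λ z → mono 1ℤ (s +ℕ p' *ℕ e) k - z) (trans (sym (ℤP.-1*i≡-i _)) (sym (sumℤ-scale p' -1ℤ (lower k)))) ⟩
        mono 1ℤ (s +ℕ p' *ℕ e) k - sumℤ p' (λ b → -1ℤ * lower k b)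
      ≡⟨ cong (λ z → mono 1ℤ (s +ℕ p' *ℕ e) k - z) (sumℤ-cong p' (λ b _ → mono-scale -1ℤ (-1ℤ ^ b) _ k)) ⟩
        mono 1ℤ (s +ℕ p' *ℕ e) k - sumP p' (λ b → mono (-1ℤ ^ suc b) (s +ℕ b *ℕ e)) k
      ∎
      where open ≡-Reasoning

  -- x^((j'+1) E - h) ≡ Σ_{a < p'} (-1)^(a+j'+1) x^((a+1) e - h)   for h ≤ e:
  -- reduce x^(j' E) to (-1)^(j') and then x^(E - h) by power-top
  power-below-multiple : ∀ j' h → h ≤ e →
    CongMod (mono 1ℤ (suc j' *ℕ E ∸ h))
            (sumP p' (λ a → mono (-1ℤ ^ (a +ℕ suc j')) (((a +ℕ 1) *ℕ e) ∸ h))) Φ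
  power-below-multiple j' h h≤e =
    cg-trans {mono 1ℤ (suc j' *ℕ E ∸ h)} {mono (-1ℤ ^ j') ((e ∸ h) +ℕ p' *ℕ e)}
             reduce-multiple reduce-top
    where
    split-off : suc j' *ℕ E ∸ h ≡ (E ∸ h) +ℕ j' *ℕ E
    split-off = ℕP.+-∸-comm (j' *ℕ E) (ℕP.≤-trans h≤e (ℕP.m≤m+n e (p' *ℕ e)))
    top-exponent : (E ∸ h) +ℕ 0 ≡ (e ∸ h) +ℕ p' *ℕ e
    top-exponent = trans (ℕP.+-identityʳ _) (ℕP.+-∸-comm (p' *ℕ e) h≤e)
    sign : ∀ a → -1ℤ ^ j' * -1ℤ ^ suc a ≡ -1ℤ ^ (a +ℕ suc j')
    sign a = trans (sym (ℤP.^-distribˡ-+-* -1ℤ j' (suc a)))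
                   (cong (-1ℤ ^_) (trans (ℕP.+-comm j' (suc a)) (sym (ℕP.+-suc a j'))))
    exponent : ∀ a → (e ∸ h) +ℕ a *ℕ e ≡ (a +ℕ 1) *ℕ e ∸ h
    exponent a = trans (sym (ℕP.+-∸-comm (a *ℕ e) h≤e)) (cong (λ z → z *ℕ e ∸ h) (ℕP.+-comm 1 a))
    rearrange : scale (-1ℤ ^ j') (sumP p' (λ a → mono (-1ℤ ^ suc a) ((e ∸ h) +ℕ a *ℕ e)))
                ≈P sumP p' (λ a → mono (-1ℤ ^ (a +ℕ suc j')) (((a +ℕ 1) *ℕ e) ∸ h))
    rearrange k = trans (sym (sumℤ-scale p' (-1ℤ ^ j') _))
                        (sumℤ-cong p' (λ a _ → trans (mono-scale (-1ℤ ^ j') (-1ℤ ^ suc a) _ k)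
                                                     (mono-cong (sign a) (exponent a) k)))
    reduce-multiple : CongMod (mono 1ℤ (suc j' *ℕ E ∸ h)) (mono (-1ℤ ^ j') ((e ∸ h) +ℕ p' *ℕ e)) Φ
    reduce-multiple = cg-resp (mono-cong refl (sym split-off)) (mono-cong refl top-exponent)
                              (cg-mono-shift (E ∸ h) (power-multiple j'))
    reduce-top : CongMod (mono (-1ℤ ^ j') ((e ∸ h) +ℕ p' *ℕ e))
                         (sumP p' (λ a → mono (-1ℤ ^ (a +ℕ suc j')) (((a +ℕ 1) *ℕ e) ∸ h))) Φ
    reduce-top = cg-resp {F = mono (-1ℤ ^ j') ((e ∸ h) +ℕ p' *ℕ e)} (λ _ → refl) rearrange (cg-mono-scale (-1ℤ ^ j') (power-top (e ∸ h)))

  below-exponent< : ∀ {a h} → a < p' → 1 ≤ h → h ≤ e → (a +ℕ 1) *ℕ e ∸ h < e *ℕ p'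
  below-exponent< {a} {h} a<p' 1≤h h≤e =
    begin-strict
      (a +ℕ 1) *ℕ e ∸ h
    ≡⟨ cong (λ z → z *ℕ e ∸ h) (ℕP.+-comm a 1) ⟩
      suc a *ℕ e ∸ h
    <⟨ ℕP.∸-monoʳ-< 1≤h (ℕP.≤-trans h≤e (ℕP.m≤m+n e (a *ℕ e))) ⟩
      suc a *ℕ e
    ≤⟨ ℕP.*-monoˡ-≤ e a<p' ⟩
      p' *ℕ e
    ≡⟨ ℕP.*-comm p' e ⟩
      e *ℕ p'
    ∎
    where open ℕP.≤-Reasoning

  IsReduction : ℕ → Poly → Set
  IsReduction l f = DegLT f (e *ℕ p') × CongMod (mono 1ℤ l) f Φ

  reductions : 1 ≤ p' → 1 ≤ e → ∀ j' i → i ≡ suc j' *ℕ E →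
      IsReduction i (mono (-1ℤ ^ suc j') 0)
    × (∀ h → 1 ≤ h → h ≤ e →
         IsReduction (i ∸ h) (sumP p' (λ a → mono (-1ℤ ^ (a +ℕ suc j')) (((a +ℕ 1) *ℕ e) ∸ h))))
    × (∀ h → 1 ≤ h → h < e *ℕ p' → IsReduction (i +ℕ h) (mono (-1ℤ ^ suc j') h))
  reductions 1≤p' 1≤e j' .(suc j' *ℕ E) refl =
      (DegLT-mono _ (ℕP.*-mono-≤ 1≤e 1≤p') , power-multiple (suc j'))
    , (λ h 1≤h h≤e → DegLT-sumP p' (λ a a<p' → DegLT-mono _ (below-exponent< a<p' 1≤h h≤e))
                   , power-below-multiple j' h h≤e)
    , (λ h _ h<deg → DegLT-mono _ h<deg , power-above-multiple (suc j') h)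

-1^[n+n]≡1 : ∀ q → -1ℤ ^ (q +ℕ q) ≡ 1ℤ
-1^[n+n]≡1 zero    = refl
-1^[n+n]≡1 (suc q) rewrite ℕP.+-suc q q | -1^[n+n]≡1 q = refl

even-or-odd : ∀ n → ∃ (λ q → n ≡ q +ℕ q) ⊎ ∃ (λ q → n ≡ suc (q +ℕ q))
even-or-odd zero    = inj₁ (0 , refl)
even-or-odd (suc n) with even-or-odd n
... | inj₁ (q , n≡q+q)   = inj₂ (q , cong suc n≡q+q)
... | inj₂ (q , n≡1+q+q) = inj₁ (suc q , trans (cong suc n≡1+q+q) (cong suc (sym (ℕP.+-suc q q))))

q+q≡q*2 : ∀ q → q +ℕ q ≡ q *ℕ 2
q+q≡q*2 q = trans (cong (q +ℕ_) (sym (ℕP.+-identityʳ q))) (ℕP.*-comm 2 q)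

-- an odd prime is 2(q+1)+1: an even prime is divisible by 2, and 1 is not prime

odd-prime : ∀ {p} → Prime p → p ≢ 2 → ∃ λ q → p ≡ suc (suc q +ℕ suc q)
odd-prime {p} p-prime p≢2 with even-or-odd p
... | inj₁ (q , p≡q+q) with prime⇒irreducible p-prime (divides q (trans p≡q+q (q+q≡q*2 q)))
...   | inj₁ ()
...   | inj₂ 2≡p = ⊥-elim (p≢2 (sym 2≡p))
odd-prime p-prime p≢2 | inj₂ (zero , refl)    = ⊥-elim (¬prime[1] p-prime)
odd-prime p-prime p≢2 | inj₂ (suc q , p≡2q+1) = q , p≡2q+1

lemma3p5 : (p j m n : ℕ) → Prime p → p ≢ 2 → 1 ≤ j → 1 ≤ m → 1 ≤ n →
    let e   = (2 ^ℕ (m ∸ 1)) *ℕ (p ^ℕ (n ∸ 1))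
        i   = j *ℕ ((2 ^ℕ (m ∸ 1)) *ℕ (p ^ℕ n))
        Φ   = sumP p (λ a → mono (-1ℤ ^ a) (a *ℕ e))
        deg = e *ℕ (p ∸ 1)
        -- f is the reduction of x^l modulo Φ: deg f < deg Φ and f ≡ x^l (mod Φ)
        IsRed : ℕ → Poly → Set
        IsRed = λ l f → DegLT f deg × CongMod (mono 1ℤ l) f Φ
    in IsRed i (mono (-1ℤ ^ j) 0)
       × (∀ h → 1 ≤ h → h ≤ e →
            IsRed (i ∸ h) (sumP (p ∸ 1) (λ a → mono (-1ℤ ^ (a +ℕ j)) (((a +ℕ 1) *ℕ e) ∸ h))))
       × (∀ h → 1 ≤ h → h < deg → IsRed (i +ℕ h) (mono (-1ℤ ^ j) h))
lemma3p5 p zero     m n        _       _   ()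
lemma3p5 p (suc j') m zero     _       _   _  _ ()
lemma3p5 p (suc j') m (suc n') p-prime p≢2 _  _ _ with odd-prime p-prime p≢2
... | q , refl = reductions (s≤s z≤n) 1≤e j' _ i≡jE
  where
  p' e : ℕ
  p' = suc q +ℕ suc q
  e  = 2 ^ℕ (m ∸ 1) *ℕ suc p' ^ℕ n'
  open Alternating p' e (-1^[n+n]≡1 (suc q))
  1≤e : 1 ≤ e
  1≤e = ℕP.*-mono-≤ (ℕP.m^n>0 2 (m ∸ 1)) (ℕP.m^n>0 (suc p') n')
  i≡jE : suc j' *ℕ (2 ^ℕ (m ∸ 1) *ℕ (suc p' *ℕ suc p' ^ℕ n')) ≡ suc j' *ℕ E
  i≡jE = cong (suc j' *ℕ_) (x∙yz≈y∙xz (2 ^ℕ (m ∸ 1)) (suc p') (suc p' ^ℕ n'))
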